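{- Let $A=\{a_i:1\le i\le 6\}\cup\{\tilde a_i:1\le i\le 6\}\cup\{\#\}$ be an alphabet of $13$ distinct symbols. For $1\le i\le 3$ define $g_i:A^2\to A$ by $g_i(bc)=a_i$ if $b=\tilde a_i$ and $c\in\{a_j:1\le j\le 3,\ j\ne i\}\cup\{\#\}$; $g_i(bc)=\tilde a_i$ if $b=a_i$ and $c\in\{a_j:1\le j\le 3,\ j\ne i\}\cup\{\#\}$; and $g_i(bc)=b$ otherwise. For $4\le i\le 6$ define $g_i$ in the same way with $\{a_j:4\le j\le 6,\ j\ne i\}$ in place of $\{a_j:1\le j\le3,\ j\ne i\}$. For $1\le i\le 6$ let $f_i:A^{\mathbb{Z}}\to A^{\mathbb{Z}}$ be given by $f_i(x)(k)=g_i(x(k)x(k+1))$, and let $\Gamma$ be the subgroup of $\mathrm{Aut}(A^{\mathbb{Z}},\#)$ generated by $f_1,\dots,f_6$. Then $\Gamma$ is isomorphic to $(\mathbb{Z}_2*\mathbb{Z}_2*\mathbb{Z}_2)^2$, and $\Gamma$ contains no almost trivial non-identity element.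
   Context: $S$ denotes the left shift on $A^{\mathbb{Z}}$, $S(x)(n)=x(n+1)$. $\mathrm{Aut}(A^{\mathbb{Z}})$ is the group of homeomorphisms $f:A^{\mathbb{Z}}\to A^{\mathbb{Z}}$ with $fS=Sf$. $(A\setminus\{\#\})^*$ is the set of finite words over $A\setminus\{\#\}$; for a finite word $w$, $[w]=\{x\in A^{\mathbb{Z}}: x(0)\cdots x(|w|-1)=w\}$. An element $f\in\mathrm{Aut}(A^{\mathbb{Z}})$ is $\#$-preserving if there is a length-preserving bijection $f^*:(A\setminus\{\#\})^*\to(A\setminus\{\#\})^*$ (said to represent $f$) with $f([\#w\#])=[\#f^*(w)\#]$ for all $w\in(A\setminus\{\#\})^*$; $\mathrm{Aut}(A^{\mathbb{Z}},\#)$ is the group of $\#$-preserving automorphisms. Such $f$ is almost trivial if $f^*(w)=w$ for all but finitely many $w\in(A\setminus\{\#\})^*$. (It is known that each $f_i$ lies in $\mathrm{Aut}(A^{\mathbb{Z}},\#)$.) $\mathbb{Z}_2*\mathbb{Z}_2*\mathbb{Z}_2$ is the free product of three copies of the group of order $2$. -}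

module Defs where

open import Data.Bool using (Bool; true; false; _∧_; not; if_then_else_)
open import Data.Bool.Properties using () renaming (_≟_ to _≟ᵇ_)
open import Data.Nat using (ℕ; zero; suc; _<ᵇ_)
open import Data.Fin using (Fin; toℕ)
open import Data.Fin.Properties using (_≟_)
open import Data.Integer using (ℤ; +_; _+_)
import Data.List
open import Data.List using (List; []; _∷_; length; foldr)
open import Data.List.Membership.Propositional using (_∈_)
open import Data.Product using (Σ; ∃; _×_; _,_)
open import Data.Unit using (⊤; tt)
open import Data.Empty using (⊥; ⊥-elim)
open import Relation.Nullary using (¬_; yes; no)
open import Relation.Nullary.Decidable using (⌊_⌋)
open import Relation.Binary.PropositionalEquality using (_≡_; refl; sym; trans; cong)

-- The alphabet A : 13 distinct symbols a_i, ã_i (i ∈ Fin 6, i.e. paper's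
-- index i+1) and #.  Letters = A ∖ {#}.

data Letter : Set where
  a  : Fin 6 → Letter
  ã  : Fin 6 → Letter

data A : Set where
  lt : Letter → A
  #  : A

Conf : Set
Conf = ℤ → A

S : Conf → Conf
S x n = x (n + + 1)

_≈c_ : Conf → Conf → Set
x ≈c y = ∀ k → x k ≡ y k

_≈_ : (Conf → Conf) → (Conf → Conf) → Set
h ≈ h' = ∀ x → h x ≈c h' x

block : Fin 6 → Bool
block i = toℕ i <ᵇ 3

sameBlock : Fin 6 → Fin 6 → Bool
sameBlock i j = ⌊ block i ≟ᵇ block j ⌋

ctx : Fin 6 → A → Bool
ctx i (lt (a j)) = not ⌊ j ≟ i ⌋ ∧ sameBlock i j
ctx i (lt (ã j)) = false
ctx i #          = true

g : Fin 6 → A → A → A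
g i (lt (a j)) c = if ⌊ j ≟ i ⌋ ∧ ctx i c then lt (ã j) else lt (a j)
g i (lt (ã j)) c = if ⌊ j ≟ i ⌋ ∧ ctx i c then lt (a j) else lt (ã j)
g i #          c = #

f : Fin 6 → Conf → Conf
f i x k = g i (x k) (x (k + + 1))

gAi : ∀ i c → g i (lt (a i)) c ≡ (if ctx i c then lt (ã i) else lt (a i))
gAi i c with i ≟ i
... | yes _ = refl
... | no ¬p = ⊥-elim (¬p refl)

gÃi : ∀ i c → g i (lt (ã i)) c ≡ (if ctx i c then lt (a i) else lt (ã i))
gÃi i c with i ≟ i
... | yes _ = refl
... | no ¬p = ⊥-elim (¬p refl)

ctxA : ∀ i → ctx i (lt (a i)) ≡ false
ctxA i with i ≟ i
... | yes _ = refl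
... | no ¬p = ⊥-elim (¬p refl)

ctx-g : ∀ i b c → ctx i (g i b c) ≡ ctx i b
ctx-g i (lt (a j)) c with j ≟ i in eq
... | no _ rewrite eq = refl
... | yes refl with ctx i c
...   | true  = refl
...   | false = ctxA i
ctx-g i (lt (ã j)) c with j ≟ i
... | no _ = refl
... | yes refl with ctx i c
...   | true  = ctxA i
...   | false = refl
ctx-g i # c = refl

g-g : ∀ i b c c' → ctx i c' ≡ ctx i c → g i (g i b c) c' ≡ b
g-g i (lt (a j)) c c' e with j ≟ i in eq
... | no _ rewrite eq = refl
... | yes refl with ctx i c
...   | true  rewrite gÃi i c' | e = refl
...   | false rewrite gAi i c' | e = refl
g-g i (lt (ã j)) c c' e with j ≟ i in eq
... | no _ rewrite eq = refl
... | yes refl with ctx i c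
...   | true  rewrite gAi i c' | e = refl
...   | false rewrite gÃi i c' | e = refl
g-g i # c c' e = refl

f-invol : ∀ i → (λ x → f i (f i x)) ≈ (λ x → x)
f-invol i x k = g-g i (x k) (x (k + + 1)) (f i x (k + + 1)) (ctx-g i (x (k + + 1)) (x ((k + + 1) + + 1)))

-- Γ : the subgroup generated by f_1,…,f_6 in the group of bijections of
-- A^ℤ (equivalently in Aut(A^ℤ,#); the generated subgroup does not
-- depend on the ambient group).

record Bij : Set where
  field
    to   : Conf → Conf
    from : Conf → Conf
    from-to : (λ x → from (to x)) ≈ (λ x → x)
    to-from : (λ x → to (from x)) ≈ (λ x → x)

fBij : Fin 6 → Bij
fBij i = record { to = f i ; from = f i ; from-to = f-invol i ; to-from = f-invol i }

-- A group word: a list of generators with exponent +1 (true) or -1 (false).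
evalWord : List (Fin 6 × Bool) → Conf → Conf
evalWord []                = λ x → x
evalWord ((i , true)  ∷ w) = λ x → Bij.to   (fBij i) (evalWord w x)
evalWord ((i , false) ∷ w) = λ x → Bij.from (fBij i) (evalWord w x)

InΓ : (Conf → Conf) → Set
InΓ h = Σ (List (Fin 6 × Bool)) λ w → h ≈ evalWord w

-- The group Z₂ * Z₂ * Z₂ : reduced words over the 3 generators
-- (no two adjacent letters equal), multiplied by concatenation and free
-- cancellation.  (Z₂*Z₂*Z₂)² is the direct product (componentwise).

Reduced : List (Fin 3) → Set
Reduced []              = ⊤
Reduced (x ∷ [])        = ⊤
Reduced (x ∷ y ∷ r)     = ¬ (x ≡ y) × Reduced (y ∷ r)

push : Fin 3 → List (Fin 3) → List (Fin 3)
push x []      = x ∷ []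
push x (y ∷ r) with x ≟ y
... | yes _ = r
... | no  _ = x ∷ y ∷ r

mulFP : List (Fin 3) → List (Fin 3) → List (Fin 3)
mulFP u v = foldr push v u

G² : Set
G² = List (Fin 3) × List (Fin 3)

ReducedG² : G² → Set
ReducedG² (u , v) = Reduced u × Reduced v

mulG² : G² → G² → G²
mulG² (u₁ , u₂) (v₁ , v₂) = (mulFP u₁ v₁ , mulFP u₂ v₂)

IsIsoOntoΓ : (G² → (Conf → Conf)) → Set
IsIsoOntoΓ φ =
    (∀ u → ReducedG² u → InΓ (φ u))
  × (∀ h → InΓ h → Σ G² λ u → ReducedG² u × (φ u ≈ h))
  × (∀ u v → ReducedG² u → ReducedG² v → φ u ≈ φ v → u ≡ v)
  × (∀ u v → ReducedG² u → ReducedG² v → φ (mulG² u v) ≈ (λ x → φ u (φ v x)))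

hashWord : List Letter → List A
hashWord w = # ∷ (Data.List.map lt w Data.List.++ (# ∷ []))

InCylAt : Conf → ℤ → List A → Set
InCylAt x k []      = ⊤
InCylAt x k (s ∷ u) = (x k ≡ s) × InCylAt x (k + + 1) u

InCyl : Conf → List A → Set
InCyl x u = InCylAt x (+ 0) u

Represents : (Conf → Conf) → (List Letter → List Letter) → Set
Represents h fs =
  ∀ w → (∀ x → InCyl x (hashWord w) → InCyl (h x) (hashWord (fs w)))
      × (∀ y → InCyl y (hashWord (fs w)) →
           Σ Conf λ x → InCyl x (hashWord w) × (h x ≈c y))

LengthPreservingBijection : (List Letter → List Letter) → Set
LengthPreservingBijection fs =
    (∀ w → length (fs w) ≡ length w)
  × Σ (List Letter → List Letter) λ fi →
      (∀ w → fi (fs w) ≡ w) × (∀ w → fs (fi w) ≡ w)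

AlmostTrivial : (Conf → Conf) → Set
AlmostTrivial h =
  Σ (List Letter → List Letter) λ fs →
      LengthPreservingBijection fs
    × Represents h fs
    × Σ (List (List Letter)) λ L → ∀ w → ¬ (w ∈ L) → fs w ≡ w

-- Each f_i is an involution, it only changes the letters a_i, ã_i, and it only reacts
-- to # and to the letters a_j of its own block; so generators of different blocks
-- commute and (u₁ , u₂) ↦ f_{u₁} ∘ f_{u₂} is a homomorphism from (Z₂*Z₂*Z₂)² onto Γ.
-- A non-empty reduced word x₁⋯xₙ of one block, applied to #ã_{x₁}^{N+1}ã_{x₂}⋯ã_{xₙ}#,
-- first turns ã_{xₙ} (followed by #) into a_{xₙ}, then each ã_{xₖ}, now followed by
-- a_{x_{k+1}} with x_{k+1} ≠ xₖ, into a_{xₖ}; the other block leaves this configuration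
-- alone.  So a non-identity element of Γ moves cylinders [#w#] with w arbitrarily long.
-- This gives injectivity, and it is impossible for an almost trivial map, which
-- preserves [#w#] for all but finitely many w.
module Submission where

open import Defs
open import Data.Bool using (Bool; true; false; _∧_; not; if_then_else_)
open import Data.Bool.Properties using (∧-zeroʳ)
open import Data.Empty using (⊥-elim)
open import Data.Fin using (Fin; zero; suc; _↑ˡ_; _↑ʳ_; splitAt; join)
open import Data.Fin.Properties using (_≟_; ↑ˡ-injective; ↑ʳ-injective; join-splitAt)
open import Data.Integer using (ℤ; +_; -[1+_]; _+_)
open import Data.List using (List; []; _∷_; _++_; map; foldr; length; replicate; reverse)
open import Data.List.Membership.Propositional using (_∉_)
open import Data.List.Properties using (map-++; foldr-++; ++-assoc; unfold-reverse)
import Data.List.Properties as List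
open import Data.List.Relation.Unary.All using (All; []; _∷_; universal)
open import Data.List.Relation.Unary.All.Properties using (map⁺)
open import Data.List.Relation.Unary.Any using (here; there)
open import Data.Nat using (ℕ; zero; suc; _<_; s≤s; z<s) renaming (_+_ to _+ℕ_)
open import Data.Nat.ListAction using (sum)
open import Data.Nat.Properties using (+-assoc; +-comm; +-identityʳ; ≤-trans; m≤m+n; m≤n+m; <⇒≱)
open import Data.Product using (Σ; ∃; _×_; _,_; proj₁)
import Data.Product.Properties as Product
open import Data.Sum using (_⊎_; inj₁; inj₂)
open import Data.Unit using (⊤; tt)
open import Function using (_∘_)
open import Relation.Binary.Bundles using (Setoid)
open import Relation.Binary.Definitions using (DecidableEquality)
open import Relation.Binary.PropositionalEquality
  using (_≡_; _≢_; refl; sym; trans; cong; cong₂; subst; _→-setoid_; module ≡-Reasoning)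
import Relation.Binary.Reasoning.Setoid as SetoidReasoning
open import Relation.Nullary using (¬_; yes; no)
open import Relation.Nullary.Decidable using (⌊_⌋; decidable-stable)

open Setoid (ℤ →-setoid A) using () renaming (sym to ≈c-sym; trans to ≈c-trans)
module ≈c-Reasoning = SetoidReasoning (ℤ →-setoid A)

f-cong : ∀ i {x y} → x ≈c y → f i x ≈c f i y
f-cong i x≈y k = cong₂ (g i) (x≈y k) (x≈y (k + + 1))

toggle : Fin 6 → A → Bool → A
toggle i (lt (a j)) t = if ⌊ j ≟ i ⌋ ∧ t then lt (ã j) else lt (a j)
toggle i (lt (ã j)) t = if ⌊ j ≟ i ⌋ ∧ t then lt (a j) else lt (ã j)
toggle i #          t = #

g≡toggle : ∀ i b c → g i b c ≡ toggle i b (ctx i c)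
g≡toggle i (lt (a j)) c = refl
g≡toggle i (lt (ã j)) c = refl
g≡toggle i #          c = refl

toggle-false : ∀ i b → toggle i b false ≡ b
toggle-false i (lt (a j)) rewrite ∧-zeroʳ ⌊ j ≟ i ⌋ = refl
toggle-false i (lt (ã j)) rewrite ∧-zeroʳ ⌊ j ≟ i ⌋ = refl
toggle-false i #          = refl

g-before-ã : ∀ i b j → g i b (lt (ã j)) ≡ b
g-before-ã i b j = trans (g≡toggle i b (lt (ã j))) (toggle-false i b)

g-ã-activated : ∀ i c → ctx i c ≡ true → g i (lt (ã i)) c ≡ lt (a i)
g-ã-activated i c active = trans (gÃi i c) (cong (if_then lt (a i) else lt (ã i)) active)

Avoids : Fin 6 → A → Set
Avoids i (lt (a j)) = j ≢ i
Avoids i (lt (ã j)) = j ≢ i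
Avoids i #          = ⊤

toggle-avoiding : ∀ i b t → Avoids i b → toggle i b t ≡ b
toggle-avoiding i (lt (a j)) t j≢i with j ≟ i
... | yes j≡i = ⊥-elim (j≢i j≡i)
... | no  _   = refl
toggle-avoiding i (lt (ã j)) t j≢i with j ≟ i
... | yes j≡i = ⊥-elim (j≢i j≡i)
... | no  _   = refl
toggle-avoiding i #          t _   = refl

toggle-preserves-Avoids : ∀ i j b t → Avoids i b → Avoids i (toggle j b t)
toggle-preserves-Avoids i j (lt (a k)) t k≢i with ⌊ k ≟ j ⌋ ∧ t
... | true  = k≢i
... | false = k≢i
toggle-preserves-Avoids i j (lt (ã k)) t k≢i with ⌊ k ≟ j ⌋ ∧ t
... | true  = k≢i
... | false = k≢i
toggle-preserves-Avoids i j #          t _   = tt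

Avoids-one-of : ∀ {i j} → i ≢ j → ∀ b → Avoids i b ⊎ Avoids j b
Avoids-one-of {i} i≢j (lt (a k)) with k ≟ i
... | no  k≢i  = inj₁ k≢i
... | yes refl = inj₂ i≢j
Avoids-one-of {i} i≢j (lt (ã k)) with k ≟ i
... | no  k≢i  = inj₁ k≢i
... | yes refl = inj₂ i≢j
Avoids-one-of i≢j # = inj₁ tt

toggle-comm : ∀ {i j} → i ≢ j → ∀ b s t → toggle i (toggle j b s) t ≡ toggle j (toggle i b t) s
toggle-comm {i} {j} i≢j b s t with Avoids-one-of i≢j b
... | inj₁ avoids-i = begin
  toggle i (toggle j b s) t  ≡⟨ toggle-avoiding i _ t (toggle-preserves-Avoids i j b s avoids-i) ⟩
  toggle j b s               ≡⟨ cong (λ b′ → toggle j b′ s) (sym (toggle-avoiding i b t avoids-i)) ⟩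
  toggle j (toggle i b t) s  ∎
  where open ≡-Reasoning
... | inj₂ avoids-j = begin
  toggle i (toggle j b s) t  ≡⟨ cong (λ b′ → toggle i b′ t) (toggle-avoiding j b s avoids-j) ⟩
  toggle i b t               ≡⟨ sym (toggle-avoiding j _ s (toggle-preserves-Avoids j i b t avoids-j)) ⟩
  toggle j (toggle i b t) s  ∎
  where open ≡-Reasoning

ctx-toggle : ∀ i j → ctx i (lt (a j)) ≡ false → ∀ c t → ctx i (toggle j c t) ≡ ctx i c
ctx-toggle i j inactive (lt (a k)) t with k ≟ j
... | no _ = refl
ctx-toggle i j inactive (lt (a k)) true  | yes refl = sym inactive
ctx-toggle i j inactive (lt (a k)) false | yes refl = refl
ctx-toggle i j inactive (lt (ã k)) t with k ≟ j
... | no _ = refl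
ctx-toggle i j inactive (lt (ã k)) true  | yes refl = inactive
ctx-toggle i j inactive (lt (ã k)) false | yes refl = refl
ctx-toggle i j inactive # t = refl

-- f_j only exchanges a_j and ã_j, and f_i ignores both as right neighbours, so f_j does
-- not change the context seen by f_i.
g-after-g : ∀ i j → ctx i (lt (a j)) ≡ false →
            ∀ b c d → g i (g j b c) (g j c d) ≡ toggle i (toggle j b (ctx j c)) (ctx i c)
g-after-g i j inactive b c d =
  trans (g≡toggle i (g j b c) (g j c d))
        (cong₂ (toggle i) (g≡toggle j b c)
               (trans (cong (ctx i) (g≡toggle j c d)) (ctx-toggle i j inactive c (ctx j d))))

f-comm : ∀ {i j} → i ≢ j → ctx i (lt (a j)) ≡ false → ctx j (lt (a i)) ≡ false →
         ∀ x → f i (f j x) ≈c f j (f i x)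
f-comm {i} {j} i≢j ij ji x k =
  let b = x k ; c = x (k + + 1) ; d = x ((k + + 1) + + 1) in
  trans (g-after-g i j ij b c d)
        (trans (toggle-comm i≢j b (ctx j c) (ctx i c)) (sym (g-after-g j i ji b c d)))

ι₁ ι₂ : Fin 3 → Fin 6
ι₁ x = x ↑ˡ 3
ι₂ y = 3 ↑ʳ y

block-ι₁ : ∀ x → block (ι₁ x) ≡ true
block-ι₁ zero             = refl
block-ι₁ (suc zero)       = refl
block-ι₁ (suc (suc zero)) = refl

blocks-ι₁≢ι₂ : ∀ x y → block (ι₁ x) ≢ block (ι₂ y)
blocks-ι₁≢ι₂ x y eq with trans (sym (block-ι₁ x)) eq
... | ()

ι₁≢ι₂ : ∀ x y → ι₁ x ≢ ι₂ y
ι₁≢ι₂ x y = blocks-ι₁≢ι₂ x y ∘ cong block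

ctx-same-block : ∀ i j → j ≢ i → block i ≡ block j → ctx i (lt (a j)) ≡ true
ctx-same-block i j j≢i same with j ≟ i | block i | block j
ctx-same-block i j j≢i _  | yes j≡i | _     | _     = ⊥-elim (j≢i j≡i)
ctx-same-block i j j≢i _  | no _    | true  | true  = refl
ctx-same-block i j j≢i _  | no _    | false | false = refl
ctx-same-block i j j≢i () | no _    | true  | false
ctx-same-block i j j≢i () | no _    | false | true

ctx-other-block : ∀ i j → block i ≢ block j → ctx i (lt (a j)) ≡ false
ctx-other-block i j differ with block i | block j
... | true  | true  = ⊥-elim (differ refl)
... | false | false = ⊥-elim (differ refl)
... | true  | false = ∧-zeroʳ (not ⌊ j ≟ i ⌋)
... | false | true  = ∧-zeroʳ (not ⌊ j ≟ i ⌋)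

MutuallyActivating : (Fin 3 → Fin 6) → Set
MutuallyActivating e = ∀ x y → x ≢ y → ctx (e x) (lt (a (e y))) ≡ true

ι₁-activating : MutuallyActivating ι₁
ι₁-activating x y x≢y =
  ctx-same-block (ι₁ x) (ι₁ y) (λ eq → x≢y (sym (↑ˡ-injective 3 y x eq)))
                 (trans (block-ι₁ x) (sym (block-ι₁ y)))

ι₂-activating : MutuallyActivating ι₂
ι₂-activating x y x≢y = ctx-same-block (ι₂ x) (ι₂ y) (λ eq → x≢y (sym (↑ʳ-injective 3 y x eq))) refl

Commuting : (Fin 3 → Fin 6) → (Fin 3 → Fin 6) → Set
Commuting e e′ = ∀ x y z → f (e x) (f (e′ y) z) ≈c f (e′ y) (f (e x) z)

ι₁ι₂-commute : Commuting ι₁ ι₂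
ι₁ι₂-commute x y = f-comm (ι₁≢ι₂ x y)
  (ctx-other-block (ι₁ x) (ι₂ y) (blocks-ι₁≢ι₂ x y))
  (ctx-other-block (ι₂ y) (ι₁ x) (blocks-ι₁≢ι₂ x y ∘ sym))

Reduced-tail : ∀ {x r} → Reduced (x ∷ r) → Reduced r
Reduced-tail {r = []}    _             = tt
Reduced-tail {r = _ ∷ _} (_ , reduced) = reduced

push-reduced : ∀ x v → Reduced v → Reduced (push x v)
push-reduced x []      _       = tt
push-reduced x (y ∷ v) reduced with x ≟ y
... | yes _   = Reduced-tail {y} {v} reduced
... | no  x≢y = x≢y , reduced

mulFP-reduced : ∀ u v → Reduced v → Reduced (mulFP u v)
mulFP-reduced []      v reduced = reduced
mulFP-reduced (x ∷ u) v reduced = push-reduced x (mulFP u v) (mulFP-reduced u v reduced)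

push-same : ∀ x v → push x (x ∷ v) ≡ v
push-same x v with x ≟ x
... | yes _   = refl
... | no  x≢x = ⊥-elim (x≢x refl)

push-distinct : ∀ {x y} v → x ≢ y → push x (y ∷ v) ≡ x ∷ y ∷ v
push-distinct {x} {y} v x≢y with x ≟ y
... | yes x≡y = ⊥-elim (x≢y x≡y)
... | no  _   = refl

push-involutive : ∀ x v → Reduced v → push x (push x v) ≡ v
push-involutive x []      _ = push-same x []
push-involutive x (y ∷ v) reduced with x ≟ y
push-involutive x (y ∷ [])    _         | yes refl = refl
push-involutive x (y ∷ z ∷ v) (y≢z , _) | yes refl = push-distinct v y≢z
... | no _ = push-same x (y ∷ v)

mulFP-identityʳ : ∀ u → Reduced u → mulFP u [] ≡ u
mulFP-identityʳ []          _                = refl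
mulFP-identityʳ (x ∷ [])    _                = refl
mulFP-identityʳ (x ∷ y ∷ u) (x≢y , reduced) =
  trans (cong (push x) (mulFP-identityʳ (y ∷ u) reduced)) (push-distinct u x≢y)

mulFP-reverse-∷ : ∀ x u v → mulFP (reverse (x ∷ u)) v ≡ mulFP (reverse u) (push x v)
mulFP-reverse-∷ x u v =
  trans (cong (foldr push v) (unfold-reverse x u)) (foldr-++ push v (reverse u) (x ∷ []))

mulFP-inverseˡ : ∀ u → mulFP (reverse u) u ≡ []
mulFP-inverseˡ []      = refl
mulFP-inverseˡ (x ∷ u) =
  trans (mulFP-reverse-∷ x u (x ∷ u)) (trans (cong (mulFP (reverse u)) (push-same x u)) (mulFP-inverseˡ u))

mulFP-cancelˡ : ∀ u v → Reduced v → mulFP u (mulFP (reverse u) v) ≡ v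
mulFP-cancelˡ []      v _       = refl
mulFP-cancelˡ (x ∷ u) v reduced = begin
  push x (mulFP u (mulFP (reverse (x ∷ u)) v))  ≡⟨ cong (push x ∘ mulFP u) (mulFP-reverse-∷ x u v) ⟩
  push x (mulFP u (mulFP (reverse u) (push x v))) ≡⟨ cong (push x) (mulFP-cancelˡ u (push x v) (push-reduced x v reduced)) ⟩
  push x (push x v)                              ≡⟨ push-involutive x v reduced ⟩
  v                                              ∎
  where open ≡-Reasoning

ε : G²
ε = [] , []

invG² : G² → G²
invG² (u₁ , u₂) = reverse u₁ , reverse u₂

mulG²-reduced : ∀ u v → ReducedG² v → ReducedG² (mulG² u v)
mulG²-reduced (u₁ , u₂) (v₁ , v₂) (r₁ , r₂) = mulFP-reduced u₁ v₁ r₁ , mulFP-reduced u₂ v₂ r₂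

mulG²-identityʳ : ∀ u → ReducedG² u → mulG² u ε ≡ u
mulG²-identityʳ (u₁ , u₂) (r₁ , r₂) = cong₂ _,_ (mulFP-identityʳ u₁ r₁) (mulFP-identityʳ u₂ r₂)

mulG²-inverseˡ : ∀ u → mulG² (invG² u) u ≡ ε
mulG²-inverseˡ (u₁ , u₂) = cong₂ _,_ (mulFP-inverseˡ u₁) (mulFP-inverseˡ u₂)

mulG²-cancelˡ : ∀ u v → ReducedG² v → mulG² u (mulG² (invG² u) v) ≡ v
mulG²-cancelˡ (u₁ , u₂) (v₁ , v₂) (r₁ , r₂) = cong₂ _,_ (mulFP-cancelˡ u₁ v₁ r₁) (mulFP-cancelˡ u₂ v₂ r₂)

_≟G²_ : DecidableEquality G²
_≟G²_ = Product.≡-dec (List.≡-dec _≟_) (List.≡-dec _≟_)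

positive : (Fin 3 → Fin 6) → List (Fin 3) → List (Fin 6 × Bool)
positive e = map (λ x → e x , true)

act : (Fin 3 → Fin 6) → List (Fin 3) → Conf → Conf
act e u = evalWord (positive e u)

φ : G² → Conf → Conf
φ (u₁ , u₂) x = act ι₁ u₁ (act ι₂ u₂ x)

evalWord-++ : ∀ w w′ x → evalWord (w ++ w′) x ≡ evalWord w (evalWord w′ x)
evalWord-++ []                w′ x = refl
evalWord-++ ((i , true)  ∷ w) w′ x = cong (f i) (evalWord-++ w w′ x)
evalWord-++ ((i , false) ∷ w) w′ x = cong (f i) (evalWord-++ w w′ x)

φ-inΓ : ∀ u → InΓ (φ u)
φ-inΓ (u₁ , u₂) = positive ι₁ u₁ ++ positive ι₂ u₂ ,
  λ x k → cong (λ y → y k) (sym (evalWord-++ (positive ι₁ u₁) (positive ι₂ u₂) x))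

act-cong : ∀ e u {x y} → x ≈c y → act e u x ≈c act e u y
act-cong e []      x≈y = x≈y
act-cong e (z ∷ u) x≈y = f-cong (e z) (act-cong e u x≈y)

φ-cong : ∀ u {x y} → x ≈c y → φ u x ≈c φ u y
φ-cong (u₁ , u₂) x≈y = act-cong ι₁ u₁ (act-cong ι₂ u₂ x≈y)

act-push : ∀ e x v y → act e (push x v) y ≈c f (e x) (act e v y)
act-push e x []      y k = refl
act-push e x (z ∷ v) y with x ≟ z
... | yes refl = ≈c-sym (f-invol (e x) (act e v y))
... | no  _    = λ k → refl

act-mulFP : ∀ e u v y → act e (mulFP u v) y ≈c act e u (act e v y)
act-mulFP e []      v y k = refl
act-mulFP e (x ∷ u) v y = ≈c-trans (act-push e x (mulFP u v) y) (f-cong (e x) (act-mulFP e u v y))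

act-f-comm : ∀ {e e′} → Commuting e e′ → ∀ u y z → act e u (f (e′ y) z) ≈c f (e′ y) (act e u z)
act-f-comm comm []      y z k = refl
act-f-comm comm (x ∷ u) y z = ≈c-trans (f-cong _ (act-f-comm comm u y z)) (comm x y (act _ u z))

act-comm : ∀ {e e′} → Commuting e e′ → ∀ u v z → act e u (act e′ v z) ≈c act e′ v (act e u z)
act-comm comm u []      z k = refl
act-comm comm u (y ∷ v) z = ≈c-trans (act-f-comm comm u y (act _ v z)) (f-cong _ (act-comm comm u v z))

φ-hom : ∀ u v → φ (mulG² u v) ≈ (λ x → φ u (φ v x))
φ-hom (u₁ , u₂) (v₁ , v₂) x = begin
  act ι₁ (mulFP u₁ v₁) (act ι₂ (mulFP u₂ v₂) x)     ≈⟨ act-cong ι₁ (mulFP u₁ v₁) (act-mulFP ι₂ u₂ v₂ x) ⟩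
  act ι₁ (mulFP u₁ v₁) (act ι₂ u₂ (act ι₂ v₂ x))    ≈⟨ act-mulFP ι₁ u₁ v₁ _ ⟩
  act ι₁ u₁ (act ι₁ v₁ (act ι₂ u₂ (act ι₂ v₂ x)))   ≈⟨ act-cong ι₁ u₁ (act-comm ι₁ι₂-commute v₁ u₂ _) ⟩
  act ι₁ u₁ (act ι₂ u₂ (act ι₁ v₁ (act ι₂ v₂ x)))   ∎
  where open ≈c-Reasoning

pushG² : Fin 3 ⊎ Fin 3 → G² → G²
pushG² (inj₁ x) (u₁ , u₂) = push x u₁ , u₂
pushG² (inj₂ y) (u₁ , u₂) = u₁ , push y u₂

pushG²-reduced : ∀ s u → ReducedG² u → ReducedG² (pushG² s u)
pushG²-reduced (inj₁ x) (u₁ , u₂) (r₁ , r₂) = push-reduced x u₁ r₁ , r₂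
pushG²-reduced (inj₂ y) (u₁ , u₂) (r₁ , r₂) = r₁ , push-reduced y u₂ r₂

φ-pushG² : ∀ s u z → φ (pushG² s u) z ≈c f (join 3 3 s) (φ u z)
φ-pushG² (inj₁ x) (u₁ , u₂) z = act-push ι₁ x u₁ (act ι₂ u₂ z)
φ-pushG² (inj₂ y) (u₁ , u₂) z =
  ≈c-trans (act-cong ι₁ u₁ (act-push ι₂ y u₂ z)) (act-f-comm ι₁ι₂-commute u₁ y (act ι₂ u₂ z))

φ-reaches-evalWord : ∀ w → Σ G² λ u → ReducedG² u × φ u ≈ evalWord w
φ-reaches-evalWord [] = ε , (tt , tt) , λ x k → refl
φ-reaches-evalWord ((i , b) ∷ w) with φ-reaches-evalWord w
... | u , reduced , φu≈w = pushG² s u , pushG²-reduced s u reduced , λ z →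
  ≈c-trans (φ-pushG²-i z) (≈c-trans (f-cong i (φu≈w z)) (f-evalWord b z))
  where
  s = splitAt 3 i
  φ-pushG²-i : ∀ z → φ (pushG² s u) z ≈c f i (φ u z)
  φ-pushG²-i z = subst (λ j → φ (pushG² s u) z ≈c f j (φ u z)) (join-splitAt 3 3 i) (φ-pushG² s u z)
  f-evalWord : ∀ b z → f i (evalWord w z) ≈c evalWord ((i , b) ∷ w) z
  f-evalWord true  z k = refl
  f-evalWord false z k = refl

φ-surjective : ∀ h → InΓ h → Σ G² λ u → ReducedG² u × φ u ≈ h
φ-surjective h (w , h≈w) with φ-reaches-evalWord w
... | u , reduced , φu≈w = u , reduced , λ x → ≈c-trans (φu≈w x) (≈c-sym (h≈w x))

-- at L n is the n-th symbol of L, and # past its end; conf L is the configuration ⋯##L##⋯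
-- with L starting at position 1.
at : List A → ℕ → A
at []      _       = #
at (b ∷ L) zero    = b
at (b ∷ L) (suc n) = at L n

conf : List A → Conf
conf L (+ n)     = at (# ∷ L) n
conf L -[1+ n ]  = #

fList : Fin 6 → List A → List A
fList i []      = []
fList i (b ∷ L) = g i b (at L 0) ∷ fList i L

actList : (Fin 3 → Fin 6) → List (Fin 3) → List A → List A
actList e []      L = L
actList e (x ∷ u) L = fList (e x) (actList e u L)

at-fList : ∀ i L n → at (fList i L) n ≡ g i (at L n) (at L (suc n))
at-fList i []      n       = refl
at-fList i (b ∷ L) zero    = refl
at-fList i (b ∷ L) (suc n) = at-fList i L n

f-conf : ∀ i L → f i (conf L) ≈c conf (fList i L)
f-conf i L (+ zero)    = refl
f-conf i L (+ suc n)   = trans (cong (g i (at L n) ∘ at L) (+-comm n 1)) (sym (at-fList i L n))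
f-conf i L -[1+ n ]    = refl

act-conf : ∀ e u L → act e u (conf L) ≈c conf (actList e u L)
act-conf e []      L k = refl
act-conf e (x ∷ u) L = ≈c-trans (f-cong (e x) (act-conf e u L)) (f-conf (e x) (actList e u L))

at-++-length : ∀ L b R → at (L ++ b ∷ R) (length L) ≡ b
at-++-length []      b R = refl
at-++-length (c ∷ L) b R = at-++-length L b R

at-++-# : ∀ L n → at (L ++ # ∷ []) n ≡ at L n
at-++-# []      zero    = refl
at-++-# []      (suc n) = refl
at-++-# (b ∷ L) zero    = refl
at-++-# (b ∷ L) (suc n) = at-++-# L n

tildes : List (Fin 6) → List Letter
tildes = map ã

map-lt-tildes-++ : ∀ P Q → map lt (tildes (P ++ Q)) ≡ map lt (tildes P) ++ map lt (tildes Q)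
map-lt-tildes-++ P Q = trans (cong (map lt) (map-++ ã P Q)) (map-++ lt (tildes P) (tildes Q))

fList-tildes-prefix : ∀ i P j L →
  fList i (map lt (tildes P) ++ lt (ã j) ∷ L) ≡ map lt (tildes P) ++ fList i (lt (ã j) ∷ L)
fList-tildes-prefix i []          j L = refl
fList-tildes-prefix i (p ∷ [])    j L = cong (_∷ _) (g-before-ã i (lt (ã p)) j)
fList-tildes-prefix i (p ∷ q ∷ P) j L =
  cong₂ _∷_ (g-before-ã i (lt (ã p)) q) (fList-tildes-prefix i (q ∷ P) j L)

fList-fixes-tildes : ∀ i P → All (_≢ i) P → fList i (map lt (tildes P)) ≡ map lt (tildes P)
fList-fixes-tildes i []      []            = refl
fList-fixes-tildes i (p ∷ P) (p≢i ∷ P≢i) =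
  cong₂ _∷_ (toggle-avoiding i (lt (ã p)) _ p≢i) (fList-fixes-tildes i P P≢i)

actList-fixes-tildes : ∀ e u P → (∀ y → All (_≢ e y) P) → actList e u (map lt (tildes P)) ≡ map lt (tildes P)
actList-fixes-tildes e []      P avoids = refl
actList-fixes-tildes e (y ∷ u) P avoids =
  trans (cong (fList (e y)) (actList-fixes-tildes e u P avoids)) (fList-fixes-tildes (e y) P (avoids y))

fList-activates : ∀ i P L → ctx i (at L 0) ≡ true →
  fList i (map lt (tildes P) ++ lt (ã i) ∷ L) ≡ map lt (tildes P) ++ lt (a i) ∷ fList i L
fList-activates i P L active =
  trans (fList-tildes-prefix i P i L)
        (cong (λ b → map lt (tildes P) ++ b ∷ fList i L) (g-ã-activated i (at L 0) active))

actList-activates-head : ∀ {e} → MutuallyActivating e → ∀ P x r → Reduced (x ∷ r) →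
  ∃ λ R → actList e (x ∷ r) (map lt (tildes (P ++ map e (x ∷ r)))) ≡ map lt (tildes P) ++ lt (a (e x)) ∷ R
actList-activates-head {e} activating P x [] _ =
  [] , trans (cong (fList (e x)) (map-lt-tildes-++ P (e x ∷ []))) (fList-activates (e x) P [] refl)
actList-activates-head {e} activating P x (y ∷ r) (x≢y , reduced)
  with actList-activates-head activating (P ++ e x ∷ []) y r reduced
... | R , activated = fList (e x) (lt (a (e y)) ∷ R) , (begin
  fList (e x) (actList e (y ∷ r) (map lt (tildes (P ++ e x ∷ map e (y ∷ r)))))
     ≡⟨ cong (λ Q → fList (e x) (actList e (y ∷ r) (map lt (tildes Q)))) (sym (++-assoc P _ _)) ⟩
  fList (e x) (actList e (y ∷ r) (map lt (tildes ((P ++ e x ∷ []) ++ map e (y ∷ r)))))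
     ≡⟨ cong (fList (e x)) activated ⟩
  fList (e x) (map lt (tildes (P ++ e x ∷ [])) ++ lt (a (e y)) ∷ R)
     ≡⟨ cong (λ L → fList (e x) (L ++ lt (a (e y)) ∷ R)) (map-lt-tildes-++ P (e x ∷ [])) ⟩
  fList (e x) ((map lt (tildes P) ++ lt (ã (e x)) ∷ []) ++ lt (a (e y)) ∷ R)
     ≡⟨ cong (fList (e x)) (++-assoc (map lt (tildes P)) _ _) ⟩
  fList (e x) (map lt (tildes P) ++ lt (ã (e x)) ∷ lt (a (e y)) ∷ R)
     ≡⟨ fList-activates (e x) P _ (activating x y x≢y) ⟩
  map lt (tildes P) ++ lt (a (e x)) ∷ fList (e x) (lt (a (e y)) ∷ R) ∎)
  where open ≡-Reasoning

InCylAt-cong : ∀ {x y} k L → x ≈c y → InCylAt x k L → InCylAt y k L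
InCylAt-cong k []      x≈y _                 = tt
InCylAt-cong k (s ∷ L) x≈y (x[k]≡s , inCyl) = trans (sym (x≈y k)) x[k]≡s , InCylAt-cong (k + + 1) L x≈y inCyl

InCylAt-++-lookup : ∀ y n L b R → InCylAt y (+ n) (L ++ b ∷ R) → y (+ (n +ℕ length L)) ≡ b
InCylAt-++-lookup y n []      b R (y[n]≡b , _) = trans (cong (y ∘ +_) (+-identityʳ n)) y[n]≡b
InCylAt-++-lookup y n (c ∷ L) b R (_ , inCyl) =
  trans (cong (y ∘ +_) (sym (+-assoc n 1 (length L)))) (InCylAt-++-lookup y (n +ℕ 1) L b R inCyl)

InCylAt-from-at : ∀ y n M → (∀ k → y (+ (n +ℕ k)) ≡ at M k) → InCylAt y (+ n) M
InCylAt-from-at y n []      _      = tt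
InCylAt-from-at y n (s ∷ M) agrees =
  trans (cong (y ∘ +_) (sym (+-identityʳ n))) (agrees 0) ,
  InCylAt-from-at y (n +ℕ 1) M (λ k → trans (cong (y ∘ +_) (+-assoc n 1 k)) (agrees (suc k)))

conf-∈-cylinder : ∀ L → InCyl (conf L) (# ∷ L ++ # ∷ [])
conf-∈-cylinder L = InCylAt-from-at (conf L) 0 (# ∷ L ++ # ∷ []) agrees
  where
  agrees : ∀ k → conf L (+ k) ≡ at (# ∷ L ++ # ∷ []) k
  agrees zero    = refl
  agrees (suc k) = sym (at-++-# L k)

conf-∉-cylinder : ∀ P b c R M → b ≢ c → ¬ InCyl (conf (P ++ b ∷ R)) ((# ∷ P) ++ c ∷ M)
conf-∉-cylinder P b c R M b≢c inCyl =
  b≢c (trans (sym (at-++-length P b R)) (InCylAt-++-lookup (conf (P ++ b ∷ R)) 0 (# ∷ P) c M inCyl))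

testWord : (Fin 3 → Fin 6) → ℕ → Fin 3 → List (Fin 3) → List Letter
testWord e N x r = tildes (map e (replicate N x ++ x ∷ r))

testWord-longer : ∀ e N x r → N < length (testWord e N x r)
testWord-longer e zero    x r = z<s
testWord-longer e (suc N) x r = s≤s (testWord-longer e N x r)

testWord-split : ∀ e N x r → testWord e N x r ≡ tildes (map e (replicate N x) ++ map e (x ∷ r))
testWord-split e N x r = cong tildes (map-++ e (replicate N x) (x ∷ r))

hashWord-testWord : ∀ e N x r → hashWord (testWord e N x r) ≡
  (# ∷ map lt (tildes (map e (replicate N x)))) ++ lt (ã (e x)) ∷ (map lt (tildes (map e r)) ++ # ∷ [])
hashWord-testWord e N x r = begin
  # ∷ map lt (testWord e N x r) ++ # ∷ []
    ≡⟨ cong (λ L → # ∷ L ++ # ∷ []) (trans (cong (map lt) (testWord-split e N x r)) (map-lt-tildes-++ P _)) ⟩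
  # ∷ (map lt (tildes P) ++ lt (ã (e x)) ∷ map lt (tildes (map e r))) ++ # ∷ []
    ≡⟨ cong (# ∷_) (++-assoc (map lt (tildes P)) _ _) ⟩
  # ∷ map lt (tildes P) ++ lt (ã (e x)) ∷ map lt (tildes (map e r)) ++ # ∷ [] ∎
  where
  open ≡-Reasoning
  P = map e (replicate N x)

act-testWord : ∀ {e} → MutuallyActivating e → ∀ N x r → Reduced (x ∷ r) →
  ∃ λ R → act e (x ∷ r) (conf (map lt (testWord e N x r)))
            ≈c conf (map lt (tildes (map e (replicate N x))) ++ lt (a (e x)) ∷ R)
act-testWord {e} activating N x r reduced
  with actList-activates-head activating (map e (replicate N x)) x r reduced
... | R , activated = R , ≈c-trans (act-conf e (x ∷ r) _) (λ k → cong (λ L → conf L k) evolved)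
  where
  evolved : actList e (x ∷ r) (map lt (testWord e N x r))
            ≡ map lt (tildes (map e (replicate N x))) ++ lt (a (e x)) ∷ R
  evolved = trans (cong (actList e (x ∷ r) ∘ map lt) (testWord-split e N x r)) activated

act-moves-testWord : ∀ {e} → MutuallyActivating e → ∀ N x r → Reduced (x ∷ r) →
  ¬ InCyl (act e (x ∷ r) (conf (map lt (testWord e N x r)))) (hashWord (testWord e N x r))
act-moves-testWord {e} activating N x r reduced inCyl with act-testWord activating N x r reduced
... | R , moved =
  conf-∉-cylinder _ _ _ R _ (λ ())
    (subst (InCyl (conf _)) (hashWord-testWord e N x r) (InCylAt-cong (+ 0) _ moved inCyl))

ι₂-fixes-ι₁-tildes : ∀ u Q → act ι₂ u (conf (map lt (tildes (map ι₁ Q)))) ≈c conf (map lt (tildes (map ι₁ Q)))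
ι₂-fixes-ι₁-tildes u Q =
  ≈c-trans (act-conf ι₂ u _)
           (λ k → cong (λ L → conf L k) (actList-fixes-tildes ι₂ u _ λ y → map⁺ (universal (λ x → ι₁≢ι₂ x y) Q)))

φ-moves-cylinder : ∀ u → ReducedG² u → u ≢ ε → ∀ N →
  ∃ λ w → N < length w × ¬ InCyl (φ u (conf (map lt w))) (hashWord w)
φ-moves-cylinder ([] , [])      _        u≢ε N = ⊥-elim (u≢ε refl)
φ-moves-cylinder (x ∷ r , u₂)   (r₁ , _) _   N =
  testWord ι₁ N x r , testWord-longer ι₁ N x r ,
  λ inCyl → act-moves-testWord ι₁-activating N x r r₁
              (InCylAt-cong (+ 0) _ (act-cong ι₁ (x ∷ r) (ι₂-fixes-ι₁-tildes u₂ _)) inCyl)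
φ-moves-cylinder ([] , x ∷ r)   (_ , r₂) _   N =
  testWord ι₂ N x r , testWord-longer ι₂ N x r , act-moves-testWord ι₂-activating N x r r₂

φ-trivial : ∀ u → ReducedG² u → φ u ≈ (λ x → x) → u ≡ ε
φ-trivial u reduced φu≈id = decidable-stable (u ≟G² ε) λ u≢ε →
  let (w , _ , moved) = φ-moves-cylinder u reduced u≢ε 0
  in  moved (InCylAt-cong (+ 0) _ (≈c-sym (φu≈id _)) (conf-∈-cylinder (map lt w)))

φ-quotient-trivial : ∀ u v → φ u ≈ φ v → φ (mulG² (invG² u) v) ≈ (λ x → x)
φ-quotient-trivial u v φu≈φv x = begin
  φ (mulG² (invG² u) v) x     ≈⟨ φ-hom (invG² u) v x ⟩
  φ (invG² u) (φ v x)         ≈⟨ φ-cong (invG² u) (≈c-sym (φu≈φv x)) ⟩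
  φ (invG² u) (φ u x)         ≈⟨ ≈c-sym (φ-hom (invG² u) u x) ⟩
  φ (mulG² (invG² u) u) x     ≡⟨ cong (λ d → φ d x) (mulG²-inverseˡ u) ⟩
  x                           ∎
  where open ≈c-Reasoning

φ-injective : ∀ u v → ReducedG² u → ReducedG² v → φ u ≈ φ v → u ≡ v
φ-injective u v ru rv φu≈φv = begin
  u                               ≡⟨ sym (mulG²-identityʳ u ru) ⟩
  mulG² u ε                       ≡⟨ cong (mulG² u) (sym u⁻¹v≡ε) ⟩
  mulG² u (mulG² (invG² u) v)     ≡⟨ mulG²-cancelˡ u v rv ⟩
  v                               ∎
  where
  open ≡-Reasoning
  u⁻¹v≡ε : mulG² (invG² u) v ≡ ε
  u⁻¹v≡ε = φ-trivial _ (mulG²-reduced (invG² u) v rv) (φ-quotient-trivial u v φu≈φv)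

∉-if-longer : ∀ (w : List Letter) L → sum (map length L) < length w → w ∉ L
∉-if-longer w (v ∷ L) longer (here refl) = <⇒≱ longer (m≤m+n (length v) _)
∉-if-longer w (v ∷ L) longer (there w∈L) =
  ∉-if-longer w L (≤-trans (s≤s (m≤n+m _ (length v))) longer) w∈L

almostTrivial-preserves-long-cylinders : ∀ h → AlmostTrivial h →
  ∃ λ N → ∀ w → N < length w → ∀ x → InCyl x (hashWord w) → InCyl (h x) (hashWord w)
almostTrivial-preserves-long-cylinders h (fs , _ , represents , L , fixes) =
  sum (map length L) , λ w longer x inCyl →
    subst (InCyl (h x) ∘ hashWord) (fixes w (∉-if-longer w L longer)) (proj₁ (represents w) x inCyl)

mainTheorem3 : Σ (G² → (Conf → Conf)) IsIsoOntoΓ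
    × ¬ (Σ (Conf → Conf) λ h → InΓ h × AlmostTrivial h × ¬ (h ≈ (λ x → x)))
mainTheorem3 = (φ , (λ u _ → φ-inΓ u) , φ-surjective , φ-injective , (λ u v _ _ → φ-hom u v)) , no-almost-trivial
  where
  no-almost-trivial : ¬ (Σ (Conf → Conf) λ h → InΓ h × AlmostTrivial h × ¬ (h ≈ (λ x → x)))
  no-almost-trivial (h , h∈Γ , almostTrivial , h≉id) =
    let (u , reduced , φu≈h)  = φ-surjective h h∈Γ
        u≢ε : u ≢ ε
        u≢ε u≡ε = h≉id λ x → ≈c-trans (≈c-sym (φu≈h x)) (λ k → cong (λ d → φ d x k) u≡ε)
        (N , preserves)       = almostTrivial-preserves-long-cylinders h almostTrivial
        (w , longer , moved)  = φ-moves-cylinder u reduced u≢ε N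
        X = conf (map lt w)
    in  moved (InCylAt-cong (+ 0) _ (≈c-sym (φu≈h X)) (preserves w longer X (conf-∈-cylinder (map lt w))))
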